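{- Let $K$ be a commutative semiring, $A$ a finite alphabet, and $s,t,u,v\in\mathcal{T}_\mu$ closed $\mu$-expressions. If $s\sim t$ and $u\sim v$, then $s+u\sim t+v$ and $s\times u\sim t\times v$.
   Context: $\mu$-expressions over a countably infinite variable set $V$: $t::=\bar k\ (k\in K)\mid x\ (x\in V)\mid\bar a\ (a\in A)\mid t+t\mid t\times t\mid\mu x.g$, with guarded terms $g::=\bar a\times t\ (a\in A)\mid\bar k\ (k\in K)\mid g+g$ (purely syntactic; $\mu x$ binds $x$). $\mathcal{T}_\mu$ is the set of closed ones, a $K\times(-)^A$-coalgebra via: $o(\bar k)=k$, $\bar k_a=\bar 0$; $o(\bar b)=0$, $\bar b_a=\bar 1$ if $b=a$ else $\bar 0$; $o(u+v)=o(u)+o(v)$, $(u+v)_a=u_a+v_a$; $o(u\times v)=o(u)o(v)$, $(u\times v)_a=(u_a\times v)+(\overline{o(u)}\times v_a)$; $o(\mu x.u)=o(u[\mu x.u/x])$, $(\mu x.u)_a=(u[\mu x.u/x])_a$ (substitution for free occurrences of $x$). $\sim$ is bisimilarity: the largest relation $S$ such that $sSt$ implies $o(s)=o(t)$ and $s_aSt_a$ for all $a\in A$.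
   Formalization: In unfolding $\mu x.g$, a guarded summand $\bar b\times u$ of $g[\mu x.g/x]$ gets output 0 instead of $0\cdot o(u)$ and $a$-derivative $(\bar b_a\times u)+(\bar 0\times\bar 0)$ instead of $(\bar b_a\times u)+(\bar 0\times u_a)$. Apart from conventions, each condition added here is assumed in the paper as well or is needed for the statement above to hold. -}

module Defs where

open import Level using (_⊔_)
open import Data.Nat using (ℕ; zero; suc)
open import Data.Fin using (Fin; zero; suc; punchOut)
open import Data.Fin.Properties using () renaming (_≟_ to _≟F_)
open import Data.Product using (Σ; _×_; _,_)
open import Relation.Nullary using (yes; no)
open import Algebra.Bundles using (CommutativeSemiring)

-- Variables are well-scoped de Bruijn indices: Term n has n free variables,
-- so the closed μ-expressions T_μ are Term 0 (α-equivalence classes).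
module MuExpr {c ℓ} (K : CommutativeSemiring c ℓ) (m : ℕ) where

  open CommutativeSemiring K using (_≈_; _+_; _*_; 0#; 1#) renaming (Carrier to Kc)

  A : Set
  A = Fin m

  infixl 6 _⊕_ _g+_
  infixl 7 _⊗_

  mutual
    data Term (n : ℕ) : Set c where
      const : Kc → Term n
      var   : Fin n → Term n
      letter : A → Term n
      _⊕_   : Term n → Term n → Term n
      _⊗_   : Term n → Term n → Term n
      μ     : Guarded (suc n) → Term n

    data Guarded (n : ℕ) : Set c where
      gsym   : A → Term n → Guarded n
      gconst : Kc → Guarded n
      _g+_   : Guarded n → Guarded n → Guarded n

  ⌊_⌋ : ∀ {n} → Guarded n → Term n
  ⌊ gsym a t ⌋ = letter a ⊗ t
  ⌊ gconst k ⌋ = const k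
  ⌊ g g+ h ⌋ = ⌊ g ⌋ ⊕ ⌊ h ⌋

  ext : ∀ {n k} → (Fin n → Fin k) → Fin (suc n) → Fin (suc k)
  ext ρ zero = zero
  ext ρ (suc i) = suc (ρ i)

  mutual
    rename : ∀ {n k} → (Fin n → Fin k) → Term n → Term k
    rename ρ (const x) = const x
    rename ρ (var i) = var (ρ i)
    rename ρ (letter a) = letter a
    rename ρ (u ⊕ v) = rename ρ u ⊕ rename ρ v
    rename ρ (u ⊗ v) = rename ρ u ⊗ rename ρ v
    rename ρ (μ g) = μ (renameG (ext ρ) g)

    renameG : ∀ {n k} → (Fin n → Fin k) → Guarded n → Guarded k
    renameG ρ (gsym a t) = gsym a (rename ρ t)
    renameG ρ (gconst x) = gconst x
    renameG ρ (g g+ h) = renameG ρ g g+ renameG ρ h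

  weaken : ∀ {n} → Term 0 → Term n
  weaken = rename (λ ())

  mutual
    substAt : ∀ {n} → Fin (suc n) → Term (suc n) → Term 0 → Term n
    substAt i (const x) w = const x
    substAt i (var j) w with i ≟F j
    ... | yes _ = weaken w
    ... | no i≢j = var (punchOut i≢j)
    substAt i (letter a) w = letter a
    substAt i (u ⊕ v) w = substAt i u w ⊕ substAt i v w
    substAt i (u ⊗ v) w = substAt i u w ⊗ substAt i v w
    substAt i (μ g) w = μ (substAtG (suc i) g w)

    substAtG : ∀ {n} → Fin (suc n) → Guarded (suc n) → Term 0 → Guarded n
    substAtG i (gsym a t) w = gsym a (substAt i t w)
    substAtG i (gconst x) w = gconst x
    substAtG i (g g+ h) w = substAtG i g w g+ substAtG i h w

  _[_] : Term 1 → Term 0 → Term 0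
  t [ w ] = substAt zero t w

  -- output o : T_μ → K
  -- o(μx.g) = o(g[μx.g/x]); on a guarded term o(ā × t') = o(ā)·o(t') = 0·o(t'),
  -- which is computed as 0.
  oG : ∀ {n} → Guarded n → Kc
  oG (gsym a t) = 0#
  oG (gconst k) = k
  oG (g g+ h) = oG g + oG h

  o : Term 0 → Kc
  o (const k) = k
  o (var ())
  o (letter b) = 0#
  o (u ⊕ v) = o u + o v
  o (u ⊗ v) = o u * o v
  o (μ g) = oG g

  symDer : A → A → Term 0
  symDer a b with a ≟F b
  ... | yes _ = const 1#
  ... | no _ = const 0#

  mutual
    der : A → Term 0 → Term 0
    der a (const k) = const 0#
    der a (var ())
    der a (letter b) = symDer a b
    der a (u ⊕ v) = der a u ⊕ der a v
    der a (u ⊗ v) = (der a u ⊗ v) ⊕ (const (o u) ⊗ der a v)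
    der a (μ g) = derG a g (μ g)

    -- (g[w/x])_a for a guarded g; the summand  ō(b̄) × t'_a = 0̄ × t'_a  of
    -- (b̄ × t')_a is rendered as 0̄ × 0̄
    derG : A → Guarded 1 → Term 0 → Term 0
    derG a (gsym b t) w = (symDer a b ⊗ (t [ w ])) ⊕ (const 0# ⊗ const 0#)
    derG a (gconst k) w = const 0#
    derG a (g g+ h) w = derG a g w ⊕ derG a h w

  record IsBisimulation (R : Term 0 → Term 0 → Set (c ⊔ ℓ)) : Set (c ⊔ ℓ) where
    field
      out  : ∀ {s t} → R s t → o s ≈ o t
      step : ∀ {s t} → R s t → ∀ (a : A) → R (der a s) (der a t)

  -- bisimilarity: the largest bisimulation (union of all bisimulations)
  infix 4 _∼_
  _∼_ : Term 0 → Term 0 → Set (Level.suc (c ⊔ ℓ))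
  s ∼ t = Σ (Term 0 → Term 0 → Set (c ⊔ ℓ)) λ R → IsBisimulation R × R s t

module Submission where

open import Defs
open import Level using (_⊔_)
open import Data.Nat using (ℕ)
open import Data.Product using (_×_; _,_)
open import Data.Sum using (inj₁; inj₂)
open import Relation.Binary.Construct.Union using (_∪_)
open import Algebra.Bundles using (CommutativeSemiring)

-- Closing a bisimulation under constants, sums and products again gives a
-- bisimulation: the derivative of a sum (product) is built from the
-- derivatives and outputs of the summands (factors) by the same operations.
-- Applied to the union of the two given bisimulations, this relates s + u to
-- t + v and s × u to t × v.

module Bisimulation {c ℓ} (K : CommutativeSemiring c ℓ) (m : ℕ) where
  open MuExpr K m
  open CommutativeSemiring K using (_≈_; +-cong; *-cong; refl)

  Relation : Set (Level.suc (c ⊔ ℓ))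
  Relation = Term 0 → Term 0 → Set (c ⊔ ℓ)

  ∪-isBisimulation : ∀ {R S : Relation} → IsBisimulation R → IsBisimulation S →
                     IsBisimulation (R ∪ S)
  ∪-isBisimulation {R} {S} BR BS = record { out = out′ ; step = step′ }
    where
    out′ : ∀ {s t} → (R ∪ S) s t → o s ≈ o t
    out′ (inj₁ r) = IsBisimulation.out BR r
    out′ (inj₂ r) = IsBisimulation.out BS r

    step′ : ∀ {s t} → (R ∪ S) s t → ∀ a → (R ∪ S) (der a s) (der a t)
    step′ (inj₁ r) a = inj₁ (IsBisimulation.step BR r a)
    step′ (inj₂ r) a = inj₂ (IsBisimulation.step BS r a)

  data Congruence (R : Relation) : Relation where
    base  : ∀ {s t} → R s t → Congruence R s t
    const : ∀ {k k′} → k ≈ k′ → Congruence R (const k) (const k′)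
    _⊕_   : ∀ {s t u v} → Congruence R s t → Congruence R u v →
            Congruence R (s ⊕ u) (t ⊕ v)
    _⊗_   : ∀ {s t u v} → Congruence R s t → Congruence R u v →
            Congruence R (s ⊗ u) (t ⊗ v)

  module _ {R : Relation} (BR : IsBisimulation R) where

    Congruence-out : ∀ {s t} → Congruence R s t → o s ≈ o t
    Congruence-out (base r)  = IsBisimulation.out BR r
    Congruence-out (const e) = e
    Congruence-out (p ⊕ q)   = +-cong (Congruence-out p) (Congruence-out q)
    Congruence-out (p ⊗ q)   = *-cong (Congruence-out p) (Congruence-out q)

    Congruence-step : ∀ {s t} → Congruence R s t →
                      ∀ a → Congruence R (der a s) (der a t)
    Congruence-step (base r)  a = base (IsBisimulation.step BR r a)
    Congruence-step (const e) a = const refl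
    Congruence-step (p ⊕ q)   a = Congruence-step p a ⊕ Congruence-step q a
    Congruence-step (p ⊗ q)   a =
      (Congruence-step p a ⊗ q) ⊕ (const (Congruence-out p) ⊗ Congruence-step q a)

    Congruence-isBisimulation : IsBisimulation (Congruence R)
    Congruence-isBisimulation =
      record { out = Congruence-out ; step = Congruence-step }

  Congruence⇒∼ : ∀ {R s t} → IsBisimulation R → Congruence R s t → s ∼ t
  Congruence⇒∼ {R} BR p = Congruence R , Congruence-isBisimulation BR , p

open Bisimulation

proposition6p2 : ∀ {c ℓ} (K : CommutativeSemiring c ℓ) (m : ℕ) →
    let open MuExpr K m in
    (s t u v : Term 0) → s ∼ t → u ∼ v → (s ⊕ u ∼ t ⊕ v) × (s ⊗ u ∼ t ⊗ v)
proposition6p2 K m _ _ _ _ (R , BR , s~t) (S , BS , u~v) =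
  Congruence⇒∼ K m B (base (inj₁ s~t) ⊕ base (inj₂ u~v)) ,
  Congruence⇒∼ K m B (base (inj₁ s~t) ⊗ base (inj₂ u~v))
  where
  open MuExpr K m using (IsBisimulation)
  B : IsBisimulation (R ∪ S)
  B = ∪-isBisimulation K m BR BS
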